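{- Let $\mathcal R$ be a TRS, $\mathcal P=\mathrm{WDP}(\mathcal R)$, and $\mu$ the usable replacement map $\mu_{\mathsf t}$ of the TRS $\mathcal P\cup\mathcal U(\mathcal P)$. Let $\mathcal A$ be an adequate $\mu$-monotone restricted matrix interpretation such that $\mathrm{WG}(\mathcal A,\mathcal P)=\max\{([\alpha]_{\mathcal A}(r))_1\dot-([\alpha]_{\mathcal A}(l))_1\mid l\to r\in\mathcal P,\ \alpha:\mathcal V\to\mathbb N^k\}$ is well-defined in $\mathbb N$ (the maximum exists). Then $\mathcal P/\mathcal U(\mathcal P)$ and $\mathcal A$ admit a weight gap on $\mathcal T_{\mathsf b}^\sharp$.
   Context: $\mathcal R$ is a TRS over finite signature $\mathcal F$ and variables $\mathcal V$; defined symbols $\mathcal D$: roots of left-hand sides; constructors $\mathcal C=\mathcal F\setminus\mathcal D$. Basic terms $f(t_1,\dots,t_n)$: $f\in\mathcal D$, $t_i\in\mathcal T(\mathcal C,\mathcal V)$; $\mathcal T^\sharp_{\mathsf b}=\{t^\sharp\mid t\text{ basic}\}$ where $t^\sharp=t$ for variables and $f^\sharp(t_1,\dots,t_n)$ for $t=f(t_1,\dots,t_n)$ ($f^\sharp$ fresh). Every term is uniquely $C[u_1,\dots,u_n]$, $C$ an $n$-hole context with no symbol of $\mathcal D$ and no variable, each $u_i$ a variable or rooted in $\mathcal D$; $\mathrm{COM}(u_1)=u_1$, $\mathrm{COM}(u_1,\dots,u_n)=c(u_1,\dots,u_n)$ ($n\ne1$, $c$ a fresh compound symbol); $\mathrm{WDP}(\mathcal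 R)$ = rules $l^\sharp\to\mathrm{COM}(u_1^\sharp,\dots,u_n^\sharp)$ for $l\to r\in\mathcal R$, $r=C[u_1,\dots,u_n]$. Usable rules: $f\rhd g$ if some $l\to r\in\mathcal R$ with root of $l$ equal to $f$ has $g\in\mathcal D$ in $r$; $\mathcal U(t)$ = rules of $\mathcal R$ with left-hand-side root $g$, $f\rhd^*g$ for some $f$ in $t$; $\mathcal U(\mathcal P)=\bigcup_{l\to r\in\mathcal P}\mathcal U(r)$. Usable replacement map of a TRS $\mathcal S$: replacement maps $\mu$ assign to $n$-ary $f$ sets $\mu(f)\subseteq\{1,\dots,n\}$, viewed as sets of pairs $(f,i)$; $\mathrm{Pos}_\mu(x)=\{\epsilon\}$, $\mathrm{Pos}_\mu(f(t_1,\dots,t_n))=\{\epsilon\}\cup\{ip\mid i\in\mu(f),p\in\mathrm{Pos}_\mu(t_i)\}$, $\mathrm{NPos}_\mu=\mathrm{Pos}\setminus\mathrm{Pos}_\mu$; $\mathrm{CAP}^s_\mu(t)$ is $t$ if $t=s|_p$ for some $p\in\mathrm{NPos}_\mu(s)$, else $u=f(\mathrm{CAP}^s_\mu(t_1),\dots,\mathrm{CAP}^s_\mu(t_n))$ if $t=f(t_1,\dots,t_n)$ and $u$ unifies with no renamed-apart left-hand side of $\mathcal S$, else a fresh variable; $\Upsilon(\mu)=\{(f,i)\mid l\to r\in\mathcal S,f(r_1,\dots,r_n)\text{ subterm of }r,\mathrm{CAP}^l_\mu(r_i)\ne r_i\}$; $\mu_{\mathsf t}$ is the least fixed point of $\Upsilon$.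 Matrix interpretation of dimension $k$: $f_{\mathcal A}(\vec v_1,\dots,\vec v_n)=F_1\vec v_1+\dots+F_n\vec v_n+\vec f$ over $\mathbb N$; $[\alpha]_{\mathcal A}$ evaluation under $\alpha$; $[t]$ evaluation with variables mapped to $\vec0$; $\vec x>\vec y$ iff $x_1>y_1$ and $x_j\ge y_j$ ($j\ge2$). $\mu$-monotone: each $f_{\mathcal A}$ strictly monotone w.r.t. $>$ in every argument $i\in\mu(f)$. Restricted: all matrices of constructor symbols of $\mathcal R$ are upper triangular with diagonal entries $\le1$. Adequate: every compound symbol $c$ is interpreted strongly linearly, $c_{\mathcal A}(\vec v_1,\dots,\vec v_n)=\vec v_1+\dots+\vec v_n+\vec c$. $\dot-$ is truncated subtraction. Relative rewriting: $s\to_{\mathcal P/\mathcal U(\mathcal P)}t$ iff $s\to^*_{\mathcal U(\mathcal P)}\cdot\to_{\mathcal P}\cdot\to^*_{\mathcal U(\mathcal P)}t$. A weight gap on $T$ for $\mathcal P/\mathcal U(\mathcal P)$ and $\mathcal A$ is $\Delta\in\mathbb N$ such that whenever $s_0\to^*_{\mathcal P\cup\mathcal U(\mathcal P)}s$ with $s_0\in T$ and $s\to_{\mathcal P}t$, then $[t]_1-[s]_1\le\Delta$. -}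

module Defs where

open import Data.Nat using (ℕ; zero; suc; _+_; _*_; _∸_; _≤_; _<_)
open import Data.Fin using (Fin; toℕ; _≟_) renaming (zero to fz; suc to fs)
open import Data.Vec using (Vec; []; _∷_; lookup; _[_]≔_; fromList)
open import Data.List using (List; []; _∷_; _++_; length; map; concat)
open import Data.List.Membership.Propositional using (_∈_)
open import Data.Product using (Σ; ∃; ∃-syntax; _×_; _,_; proj₁; proj₂)
open import Data.Sum using (_⊎_; inj₁; inj₂)
open import Data.Bool using (if_then_else_)
open import Relation.Nullary using (¬_; does)
open import Relation.Binary.PropositionalEquality using (_≡_; _≢_)
open import Relation.Binary.Construct.Closure.ReflexiveTransitive using (Star)

data Term {S : Set} (ar : S → ℕ) (V : Set) : Set where
  var : V → Term ar V
  fun : (f : S) → Vec (Term ar V) (ar f) → Term ar V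

module _ {S : Set} {ar : S → ℕ} where

  mutual
    sub : {V W : Set} → (V → Term ar W) → Term ar V → Term ar W
    sub σ (var x)    = σ x
    sub σ (fun f ts) = fun f (subs σ ts)

    subs : {V W : Set} {n : ℕ} → (V → Term ar W) → Vec (Term ar V) n → Vec (Term ar W) n
    subs σ []       = []
    subs σ (t ∷ ts) = sub σ t ∷ subs σ ts

  mapVar : {V W : Set} → (V → W) → Term ar V → Term ar W
  mapVar g = sub (λ x → var (g x))

  -- positions are lists of argument indices; At s p t means  s|_p = t
  data At {V : Set} : Term ar V → List ℕ → Term ar V → Set where
    here  : ∀ {t} → At t [] t
    there : ∀ {f ts p t} (i : Fin (ar f)) →
            At (lookup ts i) p t → At (fun f ts) (toℕ i ∷ p) t

  RootIs : {V : Set} → Term ar V → S → Set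
  RootIs t f = ∃[ ts ] (t ≡ fun f ts)

  Occurs : {V : Set} → S → Term ar V → Set
  Occurs g t = ∃[ p ] ∃[ ts ] At t p (fun g ts)

  VarIn : {V : Set} → V → Term ar V → Set
  VarIn x t = ∃[ p ] At t p (var x)

  Rule : Set → Set
  Rule V = Term ar V × Term ar V

  data Step (RS : Rule ℕ → Set) : Term ar ℕ → Term ar ℕ → Set where
    root : ∀ {l r} → RS (l , r) → (σ : ℕ → Term ar ℕ) → Step RS (sub σ l) (sub σ r)
    ctx  : ∀ {f ts u} (i : Fin (ar f)) → Step RS (lookup ts i) u →
           Step RS (fun f ts) (fun f (ts [ i ]≔ u))

module TRS {nF : ℕ} (arF : Fin nF → ℕ) (R : List (Rule {ar = arF} ℕ)) where

  Tm : Set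
  Tm = Term arF ℕ

  IsTRS : Set
  IsTRS = ∀ {l r} → (l , r) ∈ R →
          (∃[ f ] RootIs l f) × (∀ x → VarIn x r → VarIn x l)

  Defined : Fin nF → Set
  Defined f = ∃[ l ] ∃[ r ] ((l , r) ∈ R × RootIs l f)

  ConstrTerm : Tm → Set
  ConstrTerm t = ∀ f → Occurs f t → ¬ Defined f

  Basic : Tm → Set
  Basic t = ∃[ f ] ∃[ ts ] (t ≡ fun f ts × Defined f × (∀ i → ConstrTerm (lookup ts i)))

  -- extended signature: original symbols, marked symbols f♯, compound symbols
  data Sym⁺ : Set where
    orig  : Fin nF → Sym⁺
    sharp : Fin nF → Sym⁺
    com   : ℕ → Sym⁺

  ar⁺ : Sym⁺ → ℕ
  ar⁺ (orig f)  = arF f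
  ar⁺ (sharp f) = arF f
  ar⁺ (com n)   = n

  Tm⁺ : Set
  Tm⁺ = Term ar⁺ ℕ

  Rule⁺ : Set
  Rule⁺ = Rule {ar = ar⁺} ℕ

  mutual
    emb : Tm → Tm⁺
    emb (var x)    = var x
    emb (fun f ts) = fun (orig f) (embs ts)

    embs : {n : ℕ} → Vec Tm n → Vec Tm⁺ n
    embs []       = []
    embs (t ∷ ts) = emb t ∷ embs ts

  _♯ : Tm → Tm⁺
  var x ♯    = var x
  fun f ts ♯ = fun (sharp f) (embs ts)

  Basic♯ : Tm⁺ → Set
  Basic♯ s = ∃[ t ] (Basic t × s ≡ t ♯)

  -- Decomp t us : t = C[u₁,…,uₙ] with C free of defined symbols and
  -- variables, each uᵢ a variable or rooted in a defined symbol (left to right)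
  mutual
    data Decomp : Tm → List Tm → Set where
      dvar : ∀ {x} → Decomp (var x) (var x ∷ [])
      ddef : ∀ {f ts} → Defined f → Decomp (fun f ts) (fun f ts ∷ [])
      dcon : ∀ {f ts us} → ¬ Defined f → Decomps ts us → Decomp (fun f ts) us

    data Decomps : {n : ℕ} → Vec Tm n → List Tm → Set where
      dnil  : Decomps [] []
      dcons : ∀ {n t} {ts : Vec Tm n} {us vs} →
              Decomp t us → Decomps ts vs → Decomps (t ∷ ts) (us ++ vs)

  COM : List Tm⁺ → Tm⁺
  COM (u ∷ []) = u
  COM us       = fun (com (length us)) (fromList us)

  WDP : Rule⁺ → Set
  WDP ρ = ∃[ l ] ∃[ r ] ((l , r) ∈ R × ∃[ us ] (Decomp r us ×
          ρ ≡ (l ♯ , COM (map _♯ us))))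

  Defined⁺ : Sym⁺ → Set
  Defined⁺ g = ∃[ g' ] (g ≡ orig g' × Defined g')

  _▷_ : Sym⁺ → Sym⁺ → Set
  f ▷ g = ∃[ l ] ∃[ r ] ((l , r) ∈ R × RootIs (emb l) f × Defined⁺ g × Occurs g (emb r))

  U : Tm⁺ → Rule {ar = arF} ℕ → Set
  U t (l , r) = (l , r) ∈ R × ∃[ f ] ∃[ g ] (Occurs f t × Star _▷_ f g × RootIs (emb l) g)

  UP : Rule {ar = arF} ℕ → Set
  UP ρ = ∃[ ρp ] (WDP ρp × U (proj₂ ρp) ρ)

  PU : Rule⁺ → Set
  PU ρ = WDP ρ ⊎ ∃[ l ] ∃[ r ] (UP (l , r) × ρ ≡ (emb l , emb r))

  RMap : Set₁
  RMap = (f : Sym⁺) → Fin (ar⁺ f) → Set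

  data PosMu (μ : RMap) {V : Set} : Term ar⁺ V → List ℕ → Set where
    ε    : ∀ {t} → PosMu μ t []
    step : ∀ {f ts p} (i : Fin (ar⁺ f)) → μ f i →
           PosMu μ (lookup ts i) p → PosMu μ (fun f ts) (toℕ i ∷ p)

  NSub : RMap → Tm⁺ → Tm⁺ → Set
  NSub μ s t = ∃[ p ] (At s p t × ¬ PosMu μ s p)

  -- terms with fresh variables: fresh variables are inj₂ p, named by
  -- the position p (relative to the argument of CAP) they replace
  Tm⁺' : Set
  Tm⁺' = Term ar⁺ (ℕ ⊎ List ℕ)

  -- u unifies with a renamed-apart left-hand side of P ∪ U(P)
  Unif : Tm⁺' → Set
  Unif u = ∃[ l ] ∃[ r ] (PU (l , r) ×
           ∃[ σ ] ∃[ τ ] (sub {W = ℕ} σ u ≡ sub τ l))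

  -- Cap μ s p t u :  u = CAP^s_μ(t)   (t located at relative position p)
  data Cap (μ : RMap) (s : Tm⁺) : List ℕ → Tm⁺ → Tm⁺' → Set where
    nonμ   : ∀ {p t} → NSub μ s t → Cap μ s p t (mapVar inj₁ t)
    freshV : ∀ {p x} → ¬ NSub μ s (var x) → Cap μ s p (var x) (var (inj₂ p))
    keep   : ∀ {p f ts} {us : Vec Tm⁺' (ar⁺ f)} → ¬ NSub μ s (fun f ts) →
             (∀ i → Cap μ s (p ++ (toℕ i ∷ [])) (lookup ts i) (lookup us i)) →
             ¬ Unif (fun f us) → Cap μ s p (fun f ts) (fun f us)
    freshF : ∀ {p f ts} {us : Vec Tm⁺' (ar⁺ f)} → ¬ NSub μ s (fun f ts) →
             (∀ i → Cap μ s (p ++ (toℕ i ∷ [])) (lookup ts i) (lookup us i)) →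
             Unif (fun f us) → Cap μ s p (fun f ts) (var (inj₂ p))

  CAP≢ : RMap → Tm⁺ → Tm⁺ → Set
  CAP≢ μ l t = ∃[ u ] (Cap μ l [] t u × u ≢ mapVar inj₁ t)

  Υ : RMap → RMap
  Υ μ f i = ∃[ l ] ∃[ r ] (PU (l , r) × ∃[ p ] ∃[ rs ]
            (At r p (fun f rs) × CAP≢ μ l (lookup rs i)))

  IsFixed : RMap → Set
  IsFixed ν = ∀ f i → (Υ ν f i → ν f i) × (ν f i → Υ ν f i)

  IsUsableRMap : RMap → Set₁
  IsUsableRMap μ = IsFixed μ × (∀ ν → IsFixed ν → ∀ f i → μ f i → ν f i)

  ∑ : (n : ℕ) → (Fin n → ℕ) → ℕ
  ∑ zero    g = 0
  ∑ (suc n) g = g fz + ∑ n (λ i → g (fs i))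

  Vk : ℕ → Set
  Vk k = Fin k → ℕ

  Mat : ℕ → Set
  Mat k = Fin k → Fin k → ℕ

  _·ᵥ_ : {k : ℕ} → Mat k → Vk k → Vk k
  _·ᵥ_ {k} M v a = ∑ k (λ b → M a b * v b)

  record MatInt (k : ℕ) : Set where
    field
      mat : (f : Sym⁺) → Fin (ar⁺ f) → Mat k
      cst : (f : Sym⁺) → Vk k

  module _ {k : ℕ} (A : MatInt k) where
    open MatInt A

    fA : (f : Sym⁺) → (Fin (ar⁺ f) → Vk k) → Vk k
    fA f vs a = ∑ (ar⁺ f) (λ i → (mat f i ·ᵥ vs i) a) + cst f a

    mutual
      ⟦_⟧ : Tm⁺ → (ℕ → Vk k) → Vk k
      ⟦ var x ⟧ α    = α x
      ⟦ fun f ts ⟧ α = fA f (lookup (⟦_⟧s ts α))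

      ⟦_⟧s : {n : ℕ} → Vec Tm⁺ n → (ℕ → Vk k) → Vec (Vk k) n
      ⟦ [] ⟧s α     = []
      ⟦ t ∷ ts ⟧s α = ⟦ t ⟧ α ∷ ⟦ ts ⟧s α

    [_] : Tm⁺ → Vk k
    [ t ] = ⟦ t ⟧ (λ _ _ → 0)

  _>ᵥ_ : {k : ℕ} → Vk (suc k) → Vk (suc k) → Set
  x >ᵥ y = (y fz < x fz) × (∀ j → y (fs j) ≤ x (fs j))

  upd : {n : ℕ} {B : Set} → (Fin n → B) → Fin n → B → Fin n → B
  upd vs i v j = if does (j ≟ i) then v else vs j

  module _ {k : ℕ} (A : MatInt (suc k)) where
    open MatInt A

    MuMonotone : RMap → Set
    MuMonotone μ = ∀ f i → μ f i → ∀ (vs : Fin (ar⁺ f) → Vk (suc k)) (v : Vk (suc k)) →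
                   v >ᵥ vs i → fA A f (upd vs i v) >ᵥ fA A f vs

    Restricted : Set
    Restricted = ∀ f → ¬ Defined f → ∀ i →
                 (∀ a b → toℕ b < toℕ a → mat (orig f) i a b ≡ 0) ×
                 (∀ a → mat (orig f) i a a ≤ 1)

    Adequate : Set
    Adequate = ∀ n i → (∀ a → mat (com n) i a a ≡ 1) ×
                       (∀ a b → a ≢ b → mat (com n) i a b ≡ 0)

    wgval : Rule⁺ → (ℕ → Vk (suc k)) → ℕ
    wgval (l , r) α = ⟦ A ⟧ r α fz ∸ ⟦ A ⟧ l α fz

    WGDefined : Set
    WGDefined = ∃[ W ] ((∃[ ρ ] ∃[ α ] (WDP ρ × wgval ρ α ≡ W)) ×
                        (∀ ρ α → WDP ρ → wgval ρ α ≤ W))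

    WeightGap : Set
    WeightGap = ∃[ Δ ] (∀ s₀ s t → Basic♯ s₀ → Star (Step PU) s₀ s → Step WDP s t →
                        [ A ] t fz ∸ [ A ] s fz ≤ Δ)

-- Every term reachable from a marked basic term by P ∪ U(P) steps is a tree of
-- compound symbols whose leaves are unmarked terms or marked terms f♯(t₁,…,tₙ)
-- with unmarked arguments; P-steps can only happen at such marked leaves.
-- Since compound symbols are interpreted by identity matrices, the first
-- component of [s] is the sum of the first components of its leaves plus a
-- constant, so a P-step at a leaf changes [s]₁ exactly as it changes the
-- leaf, which is an instance of a rule l → r of P and hence changes by at
-- most WG(A,P).  Thus Δ = WG(A,P) is a weight gap.
module Submission where

open import Defs
open import Data.Nat using (ℕ; zero; suc; _+_; _*_; _∸_; _≤_)
open import Data.Nat.Properties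
open import Data.Fin using (Fin; toℕ) renaming (zero to fz; suc to fs)
open import Data.Vec using (Vec; []; _∷_; lookup; _[_]≔_; fromList)
open import Data.Vec.Relation.Unary.All using ([]; _∷_)
  renaming (All to Allᵥ)
open import Data.Vec.Relation.Unary.All.Properties using (lookup⁺)
open import Data.List using (List; []; _∷_; map)
open import Data.List.Membership.Propositional using (_∈_)
open import Data.List.Relation.Unary.All using (All; []; _∷_)
  renaming (map to All-map)
open import Data.List.Relation.Unary.All.Properties using (++⁺)
open import Data.Product using (∃-syntax; _,_; proj₁; proj₂)
open import Data.Sum using (inj₁; inj₂)
open import Data.Empty using (⊥-elim)
open import Relation.Nullary using (¬_)
open import Relation.Binary.PropositionalEquality
  using (_≡_; refl; sym; trans; cong; cong₂; subst; subst₂; module ≡-Reasoning)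
open import Relation.Binary.Construct.Closure.ReflexiveTransitive using (Star; ε; _◅_)

m+q≡n+p⇒m∸n≡p∸q : ∀ {m n p q} → m + q ≡ n + p → m ∸ n ≡ p ∸ q
m+q≡n+p⇒m∸n≡p∸q {m} {n} {p} {q} eq = begin
  m ∸ n             ≡⟨ sym ([m+n]∸[m+o]≡n∸o q m n) ⟩
  (q + m) ∸ (q + n) ≡⟨ cong₂ _∸_ (trans (+-comm q m) eq) (+-comm q n) ⟩
  (n + p) ∸ (n + q) ≡⟨ [m+n]∸[m+o]≡n∸o n p q ⟩
  p ∸ q             ∎
  where open ≡-Reasoning

Allᵥ-[]≔⁺ : ∀ {A : Set} {P : A → Set} {n} {xs : Vec A n} {y} →
            Allᵥ P xs → ∀ i → P y → Allᵥ P (xs [ i ]≔ y)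
Allᵥ-[]≔⁺ (_ ∷ pxs)  fz     py = py ∷ pxs
Allᵥ-[]≔⁺ (px ∷ pxs) (fs i) py = px ∷ Allᵥ-[]≔⁺ pxs i py

module _ {S : Set} {ar : S → ℕ} where

  _⊆ᵥ_ : {V : Set} → Term ar V → Term ar V → Set
  u ⊆ᵥ t = ∀ x → VarIn x u → VarIn x t

  lookup⊆ᵥfun : ∀ {V f} {ts : Vec (Term ar V) (ar f)} i → lookup ts i ⊆ᵥ fun f ts
  lookup⊆ᵥfun i x (p , at) = toℕ i ∷ p , there i at

module _ {nF : ℕ} {arF : Fin nF → ℕ} {R : List (Rule {ar = arF} ℕ)} where
  open TRS arF R

  mutual
    decomp-⊆ᵥ : ∀ {t us} → Decomp t us → All (_⊆ᵥ t) us
    decomp-⊆ᵥ dvar        = (λ _ v → v) ∷ []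
    decomp-⊆ᵥ (ddef _)    = (λ _ v → v) ∷ []
    decomp-⊆ᵥ (dcon _ ds) = decomps-⊆ᵥ ds lookup⊆ᵥfun

    decomps-⊆ᵥ : ∀ {n} {ts : Vec Tm n} {us} {t : Tm} → Decomps ts us →
                 (∀ i → lookup ts i ⊆ᵥ t) → All (_⊆ᵥ t) us
    decomps-⊆ᵥ dnil         _  = []
    decomps-⊆ᵥ (dcons d ds) ⊆t =
      ++⁺ (All-map (λ u⊆ x v → ⊆t fz x (u⊆ x v)) (decomp-⊆ᵥ d))
          (decomps-⊆ᵥ ds (λ i → ⊆t (fs i)))

  subs-embs-lookup : ∀ (σ : ℕ → Tm⁺) {n} (ts : Vec Tm n) i →
                     lookup (subs σ (embs ts)) i ≡ sub σ (emb (lookup ts i))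
  subs-embs-lookup σ (t ∷ ts) fz     = refl
  subs-embs-lookup σ (t ∷ ts) (fs i) = subs-embs-lookup σ ts i

  data Unmarked : Tm⁺ → Set where
    var  : ∀ {x} → Unmarked (var x)
    orig : ∀ {f ts} → Allᵥ Unmarked ts → Unmarked (fun (orig f) ts)

  data Marked : Tm⁺ → Set where
    unmarked : ∀ {t} → Unmarked t → Marked t
    sharp    : ∀ {f ts} → Allᵥ Unmarked ts → Marked (fun (sharp f) ts)
    com      : ∀ {n ts} → Allᵥ Marked ts → Marked (fun (com n) ts)

  UnmarkedOn : Tm → (ℕ → Tm⁺) → Set
  UnmarkedOn t σ = ∀ x → VarIn x t → Unmarked (σ x)

  mutual
    unmarked-emb : ∀ t → Unmarked (emb t)
    unmarked-emb (var x)    = var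
    unmarked-emb (fun f ts) = orig (unmarked-embs ts)

    unmarked-embs : ∀ {n} (ts : Vec Tm n) → Allᵥ Unmarked (embs ts)
    unmarked-embs []       = []
    unmarked-embs (t ∷ ts) = unmarked-emb t ∷ unmarked-embs ts

  mutual
    unmarked-sub⁺ : ∀ {σ} t → UnmarkedOn t σ → Unmarked (sub σ (emb t))
    unmarked-sub⁺ (var x)    h = h x ([] , here)
    unmarked-sub⁺ (fun f ts) h = orig (unmarked-subs⁺ ts λ i x v → h x (lookup⊆ᵥfun i x v))

    unmarked-subs⁺ : ∀ {σ n} (ts : Vec Tm n) → (∀ i → UnmarkedOn (lookup ts i) σ) →
                     Allᵥ Unmarked (subs σ (embs ts))
    unmarked-subs⁺ []       h = []
    unmarked-subs⁺ (t ∷ ts) h = unmarked-sub⁺ t (h fz) ∷ unmarked-subs⁺ ts (λ i → h (fs i))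

  unmarked-sub⁻ : ∀ {σ} t → Unmarked (sub σ (emb t)) → UnmarkedOn t σ
  unmarked-sub⁻ (var x)    u _ (_ , here) = u
  unmarked-sub⁻ {σ} (fun f ts) (orig us) x (_ , there i at) =
    unmarked-sub⁻ (lookup ts i)
      (subst Unmarked (subs-embs-lookup σ ts i) (lookup⁺ us i)) x (_ , at)

  unmarked-rule : ∀ {σ l r} → r ⊆ᵥ l → Unmarked (sub σ (emb l)) → Unmarked (sub σ (emb r))
  unmarked-rule {l = l} {r} r⊆l u = unmarked-sub⁺ r (λ x v → unmarked-sub⁻ l u x (r⊆l x v))

  ¬unmarked-sub-♯ : ∀ {σ l} → ∃[ f ] RootIs l f → ¬ Unmarked (sub σ (l ♯))
  ¬unmarked-sub-♯ (_ , _ , refl) ()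

  marked-sub-emb : ∀ {σ l} → ∃[ f ] RootIs l f → Marked (sub σ (emb l)) → Unmarked (sub σ (emb l))
  marked-sub-emb (_ , _ , refl) (unmarked u) = u

  marked-sub-♯ : ∀ {σ} u → UnmarkedOn u σ → Marked (sub σ (u ♯))
  marked-sub-♯ (var x)    h = unmarked (h x ([] , here))
  marked-sub-♯ (fun f ts) h = sharp (unmarked-subs⁺ ts λ i x v → h x (lookup⊆ᵥfun i x v))

  marked-sub-COM : ∀ {σ} us → All (λ u → Marked (sub σ (u ♯))) us →
                   Marked (sub σ (COM (map _♯ us)))
  marked-sub-COM []           []       = com []
  marked-sub-COM (u ∷ [])     (m ∷ []) = m
  marked-sub-COM (u ∷ v ∷ us) ms       = com (marked-subs-fromList (u ∷ v ∷ us) ms)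
    where
      marked-subs-fromList : ∀ {σ} us → All (λ u → Marked (sub σ (u ♯))) us →
              Allᵥ Marked (subs σ (fromList (map _♯ us)))
      marked-subs-fromList []       []       = []
      marked-subs-fromList (u ∷ us) (m ∷ ms) = m ∷ marked-subs-fromList us ms

  module _ (isTRS : IsTRS) where

    unmarked-step : ∀ {s t} → Unmarked s → Step PU s t → Unmarked t
    unmarked-step u (root (inj₁ (_ , _ , lr , _ , _ , refl)) σ) =
      ⊥-elim (¬unmarked-sub-♯ (proj₁ (isTRS lr)) u)
    unmarked-step u (root (inj₂ (_ , _ , (_ , _ , lr , _) , refl)) σ) =
      unmarked-rule (proj₂ (isTRS lr)) u
    unmarked-step (orig us) (ctx i st) =
      orig (Allᵥ-[]≔⁺ us i (unmarked-step (lookup⁺ us i) st))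

    unmarked-¬WDP-step : ∀ {s t} → Unmarked s → ¬ Step WDP s t
    unmarked-¬WDP-step u (root (_ , _ , lr , _ , _ , refl) σ) = ¬unmarked-sub-♯ (proj₁ (isTRS lr)) u
    unmarked-¬WDP-step (orig us) (ctx i st)        = unmarked-¬WDP-step (lookup⁺ us i) st

    marked-WDP-root : ∀ {σ l r us} → (l , r) ∈ R → Decomp r us →
                      Marked (sub σ (l ♯)) → Marked (sub σ (COM (map _♯ us)))
    marked-WDP-root {σ} {us = us} lr d m with isTRS lr
    ... | (f , ls , refl) , r⊆l with m
    ...   | sharp as = marked-sub-COM us
      (All-map (λ {u} u⊆r → marked-sub-♯ u (λ x v → l-unmarked x (r⊆l x (u⊆r x v))))
               (decomp-⊆ᵥ d))
      where
        l-unmarked : UnmarkedOn (fun f ls) σ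
        l-unmarked = unmarked-sub⁻ (fun f ls) (orig as)

    marked-step : ∀ {s t} → Marked s → Step PU s t → Marked t
    marked-step m (root (inj₁ (_ , _ , lr , _ , d , refl)) σ) = marked-WDP-root lr d m
    marked-step m (root (inj₂ (_ , _ , (_ , _ , lr , _) , refl)) σ) =
      unmarked (unmarked-rule (proj₂ (isTRS lr)) (marked-sub-emb (proj₁ (isTRS lr)) m))
    marked-step (unmarked u) st = unmarked (unmarked-step u st)
    marked-step (sharp us) (ctx i st) =
      sharp (Allᵥ-[]≔⁺ us i (unmarked-step (lookup⁺ us i) st))
    marked-step (com ms) (ctx i st) =
      com (Allᵥ-[]≔⁺ ms i (marked-step (lookup⁺ ms i) st))

    marked-star : ∀ {s t} → Marked s → Star (Step PU) s t → Marked t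
    marked-star m ε          = m
    marked-star m (st ◅ sts) = marked-star (marked-step m st) sts

  basic♯-marked : ∀ {s} → Basic♯ s → Marked s
  basic♯-marked (_ , (_ , ts , refl , _) , refl) = sharp (unmarked-embs ts)

  ∑-cong : ∀ n {g h : Fin n → ℕ} → (∀ i → g i ≡ h i) → ∑ n g ≡ ∑ n h
  ∑-cong zero    e = refl
  ∑-cong (suc n) e = cong₂ _+_ (e fz) (∑-cong n (λ i → e (fs i)))

  ∑-zero : ∀ n → ∑ n (λ _ → 0) ≡ 0
  ∑-zero zero    = refl
  ∑-zero (suc n) = ∑-zero n

  ∑-lookup-[]≔ : ∀ {A : Set} (g : A → ℕ) {n} (xs : Vec A n) i y →
                 ∑ n (λ j → g (lookup (xs [ i ]≔ y) j)) + g (lookup xs i) ≡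
                 ∑ n (λ j → g (lookup xs j)) + g y
  ∑-lookup-[]≔ g (x ∷ xs) fz y = begin
    g y + ∑ _ (λ j → g (lookup xs j)) + g x ≡⟨ +-assoc (g y) _ (g x) ⟩
    g y + (∑ _ (λ j → g (lookup xs j)) + g x) ≡⟨ +-comm (g y) _ ⟩
    ∑ _ (λ j → g (lookup xs j)) + g x + g y ≡⟨ cong (_+ g y) (+-comm _ (g x)) ⟩
    g x + ∑ _ (λ j → g (lookup xs j)) + g y ∎
    where open ≡-Reasoning
  ∑-lookup-[]≔ g (x ∷ xs) (fs i) y = begin
    g x + ∑ _ (λ j → g (lookup (xs [ i ]≔ y) j)) + g (lookup xs i)
      ≡⟨ +-assoc (g x) _ _ ⟩
    g x + (∑ _ (λ j → g (lookup (xs [ i ]≔ y) j)) + g (lookup xs i))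
      ≡⟨ cong (g x +_) (∑-lookup-[]≔ g xs i y) ⟩
    g x + (∑ _ (λ j → g (lookup xs j)) + g y)
      ≡⟨ sym (+-assoc (g x) _ _) ⟩
    g x + ∑ _ (λ j → g (lookup xs j)) + g y ∎
    where open ≡-Reasoning

  module _ {k : ℕ} (A : MatInt (suc k)) where
    open MatInt A

    [_]₁ : Tm⁺ → ℕ
    [ t ]₁ = [ A ] t fz

    fA-cong : ∀ f {vs ws : Fin (ar⁺ f) → Vk (suc k)} → (∀ i b → vs i b ≡ ws i b) →
              ∀ a → fA A f vs a ≡ fA A f ws a
    fA-cong f e a = cong (_+ cst f a)
      (∑-cong (ar⁺ f) (λ i → ∑-cong (suc k) (λ b → cong (mat f i a b *_) (e i b))))

    mutual
      ⟦sub⟧ : ∀ (σ : ℕ → Tm⁺) α t a → ⟦ A ⟧ (sub σ t) α a ≡ ⟦ A ⟧ t (λ x → ⟦ A ⟧ (σ x) α) a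
      ⟦sub⟧ σ α (var x)    a = refl
      ⟦sub⟧ σ α (fun f ts) a = fA-cong f (⟦subs⟧ σ α ts) a

      ⟦subs⟧ : ∀ (σ : ℕ → Tm⁺) α {n} (ts : Vec Tm⁺ n) i b →
               lookup (⟦ A ⟧s (subs σ ts) α) i b ≡ lookup (⟦ A ⟧s ts (λ x → ⟦ A ⟧ (σ x) α)) i b
      ⟦subs⟧ σ α (t ∷ ts) fz     b = ⟦sub⟧ σ α t b
      ⟦subs⟧ σ α (t ∷ ts) (fs i) b = ⟦subs⟧ σ α ts i b

    ⟦⟧s-lookup : ∀ α {n} (ts : Vec Tm⁺ n) i → lookup (⟦ A ⟧s ts α) i ≡ ⟦ A ⟧ (lookup ts i) α
    ⟦⟧s-lookup α (t ∷ ts) fz     = refl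
    ⟦⟧s-lookup α (t ∷ ts) (fs i) = ⟦⟧s-lookup α ts i

    WDP-root-gap : ∀ {W l r} (σ : ℕ → Tm⁺) → (∀ ρ α → WDP ρ → wgval A ρ α ≤ W) →
                   WDP (l , r) → [ sub σ r ]₁ ∸ [ sub σ l ]₁ ≤ W
    WDP-root-gap {l = l} {r} σ wg w =
      subst₂ (λ a b → a ∸ b ≤ _) (sym (⟦sub⟧ σ _ r fz)) (sym (⟦sub⟧ σ _ l fz))
        (wg (l , r) (λ x → ⟦ A ⟧ (σ x) _) w)

    module _ (adequate : Adequate A) where

      com-row₁ : ∀ n i (v : Vk (suc k)) → (mat (com n) i ·ᵥ v) fz ≡ v fz
      com-row₁ n i v = begin
        mat (com n) i fz fz * v fz + ∑ k (λ b → mat (com n) i fz (fs b) * v (fs b))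
          ≡⟨ cong₂ _+_ (cong (_* v fz) (proj₁ (adequate n i) fz))
                       (trans (∑-cong k (λ b → cong (_* v (fs b)) (proj₂ (adequate n i) fz (fs b) λ ())))
                              (∑-zero k)) ⟩
        1 * v fz + 0
          ≡⟨ trans (+-identityʳ _) (*-identityˡ _) ⟩
        v fz ∎
        where open ≡-Reasoning

      [com]₁ : ∀ n (ts : Vec Tm⁺ n) → [ fun (com n) ts ]₁ ≡ cst (com n) fz + ∑ n (λ i → [ lookup ts i ]₁)
      [com]₁ n ts = trans (+-comm _ (cst (com n) fz)) (cong (cst (com n) fz +_)
        (∑-cong n (λ i → trans (com-row₁ n i (lookup (⟦ A ⟧s ts α₀) i)) (cong (λ v → v fz) (⟦⟧s-lookup α₀ ts i)))))
        where
          α₀ : ℕ → Vk (suc k)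
          α₀ _ _ = 0

      [com]₁-[]≔ : ∀ n (ts : Vec Tm⁺ n) i u →
                   [ fun (com n) (ts [ i ]≔ u) ]₁ ∸ [ fun (com n) ts ]₁ ≡ [ u ]₁ ∸ [ lookup ts i ]₁
      [com]₁-[]≔ n ts i u = begin
        [ fun (com n) (ts [ i ]≔ u) ]₁ ∸ [ fun (com n) ts ]₁
          ≡⟨ cong₂ _∸_ ([com]₁ n (ts [ i ]≔ u)) ([com]₁ n ts) ⟩
        (c + ∑ n (λ j → [ lookup (ts [ i ]≔ u) j ]₁)) ∸ (c + ∑ n (λ j → [ lookup ts j ]₁))
          ≡⟨ [m+n]∸[m+o]≡n∸o c _ _ ⟩
        ∑ n (λ j → [ lookup (ts [ i ]≔ u) j ]₁) ∸ ∑ n (λ j → [ lookup ts j ]₁)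
          ≡⟨ m+q≡n+p⇒m∸n≡p∸q {p = [ u ]₁} {q = [ lookup ts i ]₁} (∑-lookup-[]≔ [_]₁ ts i u) ⟩
        [ u ]₁ ∸ [ lookup ts i ]₁ ∎
        where
          open ≡-Reasoning
          c = cst (com n) fz

      marked-WDP-gap : IsTRS → ∀ {W} → (∀ ρ α → WDP ρ → wgval A ρ α ≤ W) →
                       ∀ {s t} → Marked s → Step WDP s t → [ t ]₁ ∸ [ s ]₁ ≤ W
      marked-WDP-gap isTRS wg m (root w σ) = WDP-root-gap σ wg w
      marked-WDP-gap isTRS wg (unmarked u) st =
        ⊥-elim (unmarked-¬WDP-step isTRS u st)
      marked-WDP-gap isTRS wg (sharp us) (ctx i st) =
        ⊥-elim (unmarked-¬WDP-step isTRS (lookup⁺ us i) st)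
      marked-WDP-gap isTRS {W} wg (com {n} {ts} ms) (ctx {u = u} i st) =
        subst (_≤ W) (sym ([com]₁-[]≔ n ts i u))
          (marked-WDP-gap isTRS wg (lookup⁺ ms i) st)

lemma50 : ∀ {nF : ℕ} (arF : Fin nF → ℕ) (R : List (Rule {ar = arF} ℕ)) →
    let open TRS arF R in
    IsTRS → (k : ℕ) (A : MatInt (suc k)) (μ : RMap) →
    IsUsableRMap μ → Adequate A → MuMonotone A μ → Restricted A →
    WGDefined A → WeightGap A
lemma50 arF R isTRS k A μ _ adequate _ _ (W , _ , wg) =
  W , λ s₀ s t basic s₀→*s s→t →
    marked-WDP-gap A adequate isTRS wg (marked-star isTRS (basic♯-marked basic) s₀→*s) s→t
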